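{- Let $m$ be a positive integer and let $\zeta=(a_1,\dots,a_n)$ be a vector of integers with $a_1=0$. Let $B=(b_1,\dots,b_n)$ where $b_j=(j-1)m-a_j$ for all $j$. Then $B$ is a singleton (Ferrers) board with $\zeta=\zeta_m(B)$ if and only if: (i) $a_{j+1}\le a_j+m$ for all $1\le j<n$, and (ii) whenever neither $a_{j+1}$ nor $a_j$ is a multiple of $m$, $\lfloor a_{j+1}\rfloor_m\le\lfloor a_j\rfloor_m$.
   Context: A Ferrers board is a weakly increasing sequence $(b_1,\dots,b_n)$ of nonnegative integers (column heights). $\lfloor n\rfloor_m$ is the largest multiple of $m$ that is $\le n$ and $\rho_m(n)=n-\lfloor n\rfloor_m$. A Ferrers board is a singleton board if for all $i<n$, $\lfloor b_i\rfloor_m\ne b_i$ implies $\lfloor b_{i+1}\rfloor_m>\lfloor b_i\rfloor_m$. An $m$-zone of $B$ is a maximal interval $z=[s,t]$ of column indices with $\lfloor b_s\rfloor_m=\dots=\lfloor b_t\rfloor_m$, and $\rho_m(z)=\sum_{j\in z}\rho_m(b_j)$. The $m$-level root vector is $\zeta_m(B)=(a_1,\dots,a_n)$ with $a_j=(j-1)m-\lfloor b_j\rfloor_m-\rho_m(z)$ if $j$ is the last index in its zone $z$, and $a_j=(j-1)m-\lfloor b_j\rfloor_m$ otherwise. -}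

module Defs where

open import Data.Nat.Base as ℕ using (ℕ; zero; suc; NonZero)
open import Data.Integer.Base using (ℤ; +_; _+_; _-_; _*_; _≤_; _<_; _/ℕ_)
open import Data.Integer.Properties using (_≟_)
open import Data.Fin.Base using (Fin; zero; suc; toℕ; inject₁)
open import Data.Bool.Base using (Bool; true; false; not; if_then_else_)
open import Data.Product.Base using (_×_)
open import Function.Base using (_∘_)
open import Relation.Binary.PropositionalEquality using (_≡_; _≢_)
import Relation.Nullary.Decidable as Dec

-- Boards / vectors with n+1 entries are functions Fin (suc n) → ℤ;
-- column j (1-based in the paper) is the index j-1 : Fin (suc n) here.

⌊_⌋[_] : ℤ → (m : ℕ) → .{{NonZero m}} → ℤ
⌊ x ⌋[ m ] = (x /ℕ m) * + m

ρ[_] : (m : ℕ) → .{{NonZero m}} → ℤ → ℤ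
ρ[ m ] x = x - ⌊ x ⌋[ m ]

IsFerrers : ∀ {n} → (Fin (suc n) → ℤ) → Set
IsFerrers {n} b = (∀ j → + 0 ≤ b j) × (∀ (i : Fin n) → b (inject₁ i) ≤ b (suc i))

IsSingletonBoard : (m : ℕ) → .{{NonZero m}} → ∀ {n} → (Fin (suc n) → ℤ) → Set
IsSingletonBoard m {n} b =
  IsFerrers b ×
  (∀ (i : Fin n) → ⌊ b (inject₁ i) ⌋[ m ] ≢ b (inject₁ i) →
     ⌊ b (inject₁ i) ⌋[ m ] < ⌊ b (suc i) ⌋[ m ])

-- isLast m b j : j is the last index of its m-zone, i.e. j is the final
-- column or ⌊ b_{j+1} ⌋_m ≠ ⌊ b_j ⌋_m (zones are maximal intervals of
-- indices with constant ⌊ b ⌋_m).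
isLast : (m : ℕ) → .{{NonZero m}} → ∀ {n} → (Fin (suc n) → ℤ) → Fin (suc n) → Bool
isLast m {zero}  f zero    = true
isLast m {suc n} f zero    = not (Dec.⌊ ⌊ f zero ⌋[ m ] ≟ ⌊ f (suc zero) ⌋[ m ] ⌋)
isLast m {suc n} f (suc i) = isLast m (f ∘ suc) i

runSum : (m : ℕ) → .{{NonZero m}} → ∀ {n} → (Fin (suc n) → ℤ) → ℤ → Fin (suc n) → ℤ
runSum m {n} f c zero =
  if Dec.⌊ ⌊ f zero ⌋[ m ] ≟ c ⌋ then ρ[ m ] (f zero) else + 0
runSum m {suc n} f c (suc i) =
  if Dec.⌊ ⌊ f (suc i) ⌋[ m ] ≟ c ⌋
  then ρ[ m ] (f (suc i)) + runSum m (f ∘ inject₁) c i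
  else + 0

-- ρ_m(z) for the zone z whose last index is t: sum of ρ_m(b_j) over z = [s,t]
zoneρ : (m : ℕ) → .{{NonZero m}} → ∀ {n} → (Fin (suc n) → ℤ) → Fin (suc n) → ℤ
zoneρ m b t = runSum m b ⌊ b t ⌋[ m ] t

-- the m-level root vector ζ_m(B); with 0-based index j, (j-1)m becomes j·m
ζ[_] : (m : ℕ) → .{{NonZero m}} → ∀ {n} → (Fin (suc n) → ℤ) → Fin (suc n) → ℤ
ζ[ m ] b j =
  if isLast m b j
  then + (toℕ j ℕ.* m) - ⌊ b j ⌋[ m ] - zoneρ m b j
  else + (toℕ j ℕ.* m) - ⌊ b j ⌋[ m ]

-- Since (j-1)m is a multiple of m, floors reflect:
-- ⌊(j-1)m - x⌋_m is (j-1)m - x when m ∣ x and (j-1)m - ⌊x⌋_m - m otherwise.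
-- Under this reflection b_j ≤ b_{j+1} is condition (i), and the singleton
-- condition on columns j, j+1 is condition (ii) (given (i)); b_1 = 0 makes the
-- board nonnegative.  On a singleton board every column other than the last of
-- its zone is a multiple of m, so ρ_m(z) is the remainder of the last column
-- alone and ζ_m(B)_j = (j-1)m - b_j = a_j.
module Submission where

open import Data.Bool.Base using (true; false)
open import Data.Fin.Base using (Fin; zero; suc; toℕ; inject₁)
open import Data.Fin.Properties using (toℕ-inject₁)
open import Data.Integer.Base using (ℤ; +_; _+_; _-_; _*_; _≤_; _<_; _/ℕ_; _%ℕ_; +<+)
open import Data.Integer.Divisibility using (_∣_)
open import Data.Integer.Divisibility.Signed
  using (divides; ∣ᵤ⇒∣; ∣⇒∣ᵤ; ∣-refl; ∣m∣n⇒∣m+n; ∣m∣n⇒∣m-n)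
  renaming (_∣_ to _∣ₛ_; _∣?_ to _∣ₛ?_)
open import Data.Integer.DivMod using (a≡a%ℕn+[a/ℕn]*n; n<s[n/ℕd]*d)
open import Data.Integer.Properties
open import Data.Integer.Tactic.RingSolver using (solve-∀)
open import Data.Nat.Base using (ℕ; suc; NonZero)
import Data.Nat.Base as ℕ
open import Data.Product.Base using (_×_; _,_)
open import Function.Base using (_∘_)
open import Function.Bundles using (_⇔_; mk⇔; Equivalence)
open import Relation.Binary.PropositionalEquality
  using (_≡_; _≢_; refl; sym; trans; cong; cong₂; subst; subst₂)
open import Relation.Nullary using (¬_; Dec; yes; no; contradiction)

open import Defs

≤-by-diff : ∀ {x y x′ y′} → x ≤ y → y - x ≡ y′ - x′ → x′ ≤ y′
≤-by-diff x≤y eq = 0≤i-j⇒j≤i (subst (+ 0 ≤_) eq (i≤j⇒0≤j-i x≤y))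

<-by-diff : ∀ {x y x′ y′} → x < y → y - x ≡ y′ - x′ → x′ < y′
<-by-diff {x} {y} {x′} {y′} x<y eq =
  suc[i]≤j⇒i<j (≤-by-diff (i<j⇒suc[i]≤j x<y)
    (trans (shift y x) (trans (cong (_- + 1) eq) (sym (shift y′ x′)))))
  where
  shift : ∀ y x → y - (+ 1 + x) ≡ (y - x) - + 1
  shift = solve-∀

t-x≤k+t-y⇔y≤x+k : ∀ t k x y → (t - x ≤ (k + t) - y) ⇔ (y ≤ x + k)
t-x≤k+t-y⇔y≤x+k t k x y =
  mk⇔ (λ le → ≤-by-diff le (gap t k x y)) (λ le → ≤-by-diff le (sym (gap t k x y)))
  where
  gap : ∀ t k x y → ((k + t) - y) - (t - x) ≡ (x + k) - y
  gap = solve-∀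

t-x-k<k+t-y-k⇔y<x+k : ∀ t k x y → (t - x - k < (k + t) - y - k) ⇔ (y < x + k)
t-x-k<k+t-y-k⇔y<x+k t k x y =
  mk⇔ (λ lt → <-by-diff lt (gap t k x y)) (λ lt → <-by-diff lt (sym (gap t k x y)))
  where
  gap : ∀ t k x y → ((k + t) - y - k) - (t - x - k) ≡ (x + k) - y
  gap = solve-∀

t-[t-x]≡x : ∀ t x → t - (t - x) ≡ x
t-[t-x]≡x = solve-∀

monotone⇒head≤ : ∀ {n} (g : Fin (suc n) → ℤ) → (∀ (i : Fin n) → g (inject₁ i) ≤ g (suc i)) →
                 ∀ j → g zero ≤ g j
monotone⇒head≤ g mono zero = ≤-refl
monotone⇒head≤ {suc n} g mono (suc j) =
  ≤-trans (mono zero) (monotone⇒head≤ (g ∘ suc) (mono ∘ suc) j)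

module _ (m : ℕ) .{{_ : NonZero m}} where

  m∣⌊x⌋ : ∀ x → + m ∣ₛ ⌊ x ⌋[ m ]
  m∣⌊x⌋ x = divides (x /ℕ m) refl

  ⌊x⌋≤x : ∀ x → ⌊ x ⌋[ m ] ≤ x
  ⌊x⌋≤x x = subst (⌊ x ⌋[ m ] ≤_) (sym (a≡a%ℕn+[a/ℕn]*n x m)) (i≤j+i _ (+ (x %ℕ m)))

  x<⌊x⌋+m : ∀ x → x < ⌊ x ⌋[ m ] + + m
  x<⌊x⌋+m x = subst (x <_) (next-multiple (x /ℕ m) (+ m)) (n<s[n/ℕd]*d x m)
    where
    next-multiple : ∀ q k → (+ 1 + q) * k ≡ q * k + k
    next-multiple = solve-∀

  x<x+m : ∀ x → x < x + + m
  x<x+m x = subst (_< x + + m) (+-identityʳ x) (+-monoʳ-< x (+<+ (ℕ.>-nonZero⁻¹ m)))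

  ∣∧∣∧<+m⇒≤ : ∀ {p q} → + m ∣ₛ p → + m ∣ₛ q → p < q + + m → p ≤ q
  ∣∧∣∧<+m⇒≤ (divides u refl) (divides v refl) lt = *-monoʳ-≤-nonNeg (+ m) u≤v
    where
    next-multiple : ∀ v k → v * k + k ≡ (+ 1 + v) * k
    next-multiple = solve-∀
    u<1+v : u < + 1 + v
    u<1+v = *-cancelʳ-<-nonNeg (+ m) (subst (u * + m <_) (next-multiple v (+ m)) lt)
    u≤v : u ≤ v
    u≤v = subst (u ≤_) (pred-suc v) (i<j⇒i≤pred[j] u<1+v)

  ⌊⌋-unique : ∀ {p y} → + m ∣ₛ p → p ≤ y → y < p + + m → ⌊ y ⌋[ m ] ≡ p
  ⌊⌋-unique {p} {y} m∣p p≤y y<p+m = ≤-antisym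
    (∣∧∣∧<+m⇒≤ (m∣⌊x⌋ y) m∣p (≤-<-trans (⌊x⌋≤x y) y<p+m))
    (∣∧∣∧<+m⇒≤ m∣p (m∣⌊x⌋ y) (≤-<-trans p≤y (x<⌊x⌋+m y)))

  ⌊x⌋≡x : ∀ {x} → + m ∣ₛ x → ⌊ x ⌋[ m ] ≡ x
  ⌊x⌋≡x {x} m∣x = ⌊⌋-unique m∣x ≤-refl (x<x+m x)

  ∤⇒⌊x⌋<x : ∀ {x} → ¬ (+ m ∣ₛ x) → ⌊ x ⌋[ m ] < x
  ∤⇒⌊x⌋<x {x} m∤x = ≤∧≢⇒< (⌊x⌋≤x x) (λ eq → m∤x (subst (+ m ∣ₛ_) eq (m∣⌊x⌋ x)))

  m∣t∧m∣t-x⇒m∣x : ∀ {t x} → + m ∣ₛ t → + m ∣ₛ t - x → + m ∣ₛ x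
  m∣t∧m∣t-x⇒m∣x {t} {x} m∣t m∣t-x = subst (+ m ∣ₛ_) (t-[t-x]≡x t x) (∣m∣n⇒∣m-n m∣t m∣t-x)

  t-⌊x⌋-m<t-x : ∀ t x → t - ⌊ x ⌋[ m ] - + m < t - x
  t-⌊x⌋-m<t-x t x = <-by-diff (x<⌊x⌋+m x) (gap t x ⌊ x ⌋[ m ] (+ m))
    where
    gap : ∀ t x f k → (f + k) - x ≡ (t - x) - (t - f - k)
    gap = solve-∀

  ⌊t-x⌋≡t-⌊x⌋-m : ∀ {t x} → + m ∣ₛ t → ¬ (+ m ∣ₛ x) → ⌊ t - x ⌋[ m ] ≡ t - ⌊ x ⌋[ m ] - + m
  ⌊t-x⌋≡t-⌊x⌋-m {t} {x} m∣t m∤x = ⌊⌋-unique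
    (∣m∣n⇒∣m-n (∣m∣n⇒∣m-n m∣t (m∣⌊x⌋ x)) ∣-refl)
    (<⇒≤ (t-⌊x⌋-m<t-x t x))
    (<-by-diff (∤⇒⌊x⌋<x m∤x) (gap t x ⌊ x ⌋[ m ] (+ m)))
    where
    gap : ∀ t x f k → x - f ≡ (t - f - k + k) - (t - x)
    gap = solve-∀

  SingletonStep : ℤ → ℤ → Set
  SingletonStep u v = ⌊ u ⌋[ m ] ≢ u → ⌊ u ⌋[ m ] < ⌊ v ⌋[ m ]

  singletonStep⇒⌊y⌋≤⌊x⌋ : ∀ t x y → + m ∣ₛ t → ¬ (+ m ∣ x) → ¬ (+ m ∣ y) →
                          SingletonStep (t - x) ((+ m + t) - y) → ⌊ y ⌋[ m ] ≤ ⌊ x ⌋[ m ]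
  singletonStep⇒⌊y⌋≤⌊x⌋ t x y m∣t m∤x m∤y step =
    ∣∧∣∧<+m⇒≤ (m∣⌊x⌋ y) (m∣⌊x⌋ x)
      (Equivalence.to (t-x-k<k+t-y-k⇔y<x+k t (+ m) ⌊ x ⌋[ m ] ⌊ y ⌋[ m ]) floors<)
    where
    m∤ₛx : ¬ (+ m ∣ₛ x)
    m∤ₛx = m∤x ∘ ∣⇒∣ᵤ
    t-x-inexact : ⌊ t - x ⌋[ m ] ≢ t - x
    t-x-inexact = <⇒≢ (∤⇒⌊x⌋<x (m∤ₛx ∘ m∣t∧m∣t-x⇒m∣x m∣t))
    floors< : t - ⌊ x ⌋[ m ] - + m < (+ m + t) - ⌊ y ⌋[ m ] - + m
    floors< = subst₂ _<_ (⌊t-x⌋≡t-⌊x⌋-m m∣t m∤ₛx)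
                         (⌊t-x⌋≡t-⌊x⌋-m (∣m∣n⇒∣m+n ∣-refl m∣t) (m∤y ∘ ∣⇒∣ᵤ))
                         (step t-x-inexact)

  ⌊y⌋≤⌊x⌋⇒singletonStep : ∀ t x y → + m ∣ₛ t → y ≤ x + + m →
                          (¬ (+ m ∣ y) → ¬ (+ m ∣ x) → ⌊ y ⌋[ m ] ≤ ⌊ x ⌋[ m ]) →
                          SingletonStep (t - x) ((+ m + t) - y)
  ⌊y⌋≤⌊x⌋⇒singletonStep t x y m∣t y≤x+m floors≤ t-x-inexact =
    subst (_< ⌊ (+ m + t) - y ⌋[ m ]) (sym (⌊t-x⌋≡t-⌊x⌋-m m∣t m∤x)) (below (+ m ∣ₛ? y))
    where
    m∣m+t : + m ∣ₛ + m + t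
    m∣m+t = ∣m∣n⇒∣m+n ∣-refl m∣t
    m∤x : ¬ (+ m ∣ₛ x)
    m∤x m∣x = t-x-inexact (⌊x⌋≡x (∣m∣n⇒∣m-n m∣t m∣x))
    below : Dec (+ m ∣ₛ y) → t - ⌊ x ⌋[ m ] - + m < ⌊ (+ m + t) - y ⌋[ m ]
    below (yes m∣y) = subst (t - ⌊ x ⌋[ m ] - + m <_) (sym (⌊x⌋≡x (∣m∣n⇒∣m-n m∣m+t m∣y)))
      (<-≤-trans (t-⌊x⌋-m<t-x t x) (Equivalence.from (t-x≤k+t-y⇔y≤x+k t (+ m) x y) y≤x+m))
    below (no m∤y) = subst (t - ⌊ x ⌋[ m ] - + m <_) (sym (⌊t-x⌋≡t-⌊x⌋-m m∣m+t m∤y))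
      (Equivalence.from (t-x-k<k+t-y-k⇔y<x+k t (+ m) ⌊ x ⌋[ m ] ⌊ y ⌋[ m ])
        (≤-<-trans (floors≤ (m∤y ∘ ∣ᵤ⇒∣) (m∤x ∘ ∣ᵤ⇒∣)) (x<x+m ⌊ x ⌋[ m ])))

  RemaindersAtZoneEnds : ∀ {n} → (Fin (suc n) → ℤ) → Set
  RemaindersAtZoneEnds {n} b =
    ∀ (i : Fin n) → ⌊ b (inject₁ i) ⌋[ m ] ≡ ⌊ b (suc i) ⌋[ m ] → ρ[ m ] (b (inject₁ i)) ≡ + 0

  singleton⇒remaindersAtZoneEnds : ∀ {n} (b : Fin (suc n) → ℤ) →
    (∀ (i : Fin n) → SingletonStep (b (inject₁ i)) (b (suc i))) → RemaindersAtZoneEnds b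
  singleton⇒remaindersAtZoneEnds b step i same with ⌊ b (inject₁ i) ⌋[ m ] ≟ b (inject₁ i)
  ... | yes exact = i≡j⇒i-j≡0 (sym exact)
  ... | no inexact = contradiction same (<⇒≢ (step i inexact))

  runSum≡0 : ∀ {n} (b : Fin (suc n) → ℤ) c i → RemaindersAtZoneEnds b →
             (⌊ b i ⌋[ m ] ≡ c → ρ[ m ] (b i) ≡ + 0) → runSum m b c i ≡ + 0
  runSum≡0 b c zero _ ρ≡0 with ⌊ b zero ⌋[ m ] ≟ c
  ... | yes same = ρ≡0 same
  ... | no _ = refl
  runSum≡0 {suc n} b c (suc i) rem ρ≡0 with ⌊ b (suc i) ⌋[ m ] ≟ c
  ... | yes same = cong₂ _+_ (ρ≡0 same)
    (runSum≡0 (b ∘ inject₁) c i (rem ∘ inject₁) (λ same′ → rem i (trans same′ (sym same))))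
  ... | no _ = refl

  zoneρ≡ρ : ∀ {n} (b : Fin (suc n) → ℤ) j → RemaindersAtZoneEnds b → zoneρ m b j ≡ ρ[ m ] (b j)
  zoneρ≡ρ b zero _ with ⌊ b zero ⌋[ m ] ≟ ⌊ b zero ⌋[ m ]
  ... | yes _ = refl
  ... | no differ = contradiction refl differ
  zoneρ≡ρ {suc n} b (suc i) rem with ⌊ b (suc i) ⌋[ m ] ≟ ⌊ b (suc i) ⌋[ m ]
  ... | yes _ =
    trans (cong (_+_ (ρ[ m ] (b (suc i)))) (runSum≡0 (b ∘ inject₁) _ i (rem ∘ inject₁) (rem i)))
          (+-identityʳ _)
  ... | no differ = contradiction refl differ

  notLast⇒ρ≡0 : ∀ {n} (b : Fin (suc n) → ℤ) j → RemaindersAtZoneEnds b →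
                isLast m b j ≡ false → ρ[ m ] (b j) ≡ + 0
  notLast⇒ρ≡0 {suc n} b zero rem notLast with ⌊ b zero ⌋[ m ] ≟ ⌊ b (suc zero) ⌋[ m ]
  ... | yes same = rem zero same
  notLast⇒ρ≡0 {suc n} b (suc i) rem notLast = notLast⇒ρ≡0 (b ∘ suc) i (rem ∘ suc) notLast

  ζ≡jm-b : ∀ {n} (b : Fin (suc n) → ℤ) → RemaindersAtZoneEnds b →
           ∀ j → ζ[ m ] b j ≡ + (toℕ j ℕ.* m) - b j
  ζ≡jm-b b rem j with isLast m b j in last
  ... | true = trans (cong (t - ⌊ b j ⌋[ m ] -_) (zoneρ≡ρ b j rem)) (cancel t (b j) ⌊ b j ⌋[ m ])
    where
    t : ℤ
    t = + (toℕ j ℕ.* m)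
    cancel : ∀ t x f → t - f - (x - f) ≡ t - x
    cancel = solve-∀
  ... | false = cong (+ (toℕ j ℕ.* m) -_) (sym (i-j≡0⇒i≡j (b j) _ (notLast⇒ρ≡0 b j rem last)))

module Board (m : ℕ) .{{_ : NonZero m}} {n : ℕ} (a : Fin (suc n) → ℤ) where

  board : Fin (suc n) → ℤ
  board j = + (toℕ j ℕ.* m) - a j

  StepsBounded : Set
  StepsBounded = ∀ (j : Fin n) → a (suc j) ≤ a (inject₁ j) + + m

  InexactFloorsNonIncreasing : Set
  InexactFloorsNonIncreasing =
    ∀ (j : Fin n) → ¬ (+ m ∣ a (suc j)) → ¬ (+ m ∣ a (inject₁ j)) →
    ⌊ a (suc j) ⌋[ m ] ≤ ⌊ a (inject₁ j) ⌋[ m ]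

  private
    offset : Fin n → ℤ
    offset j = + (toℕ j ℕ.* m)

    m∣offset : ∀ j → + m ∣ₛ offset j
    m∣offset j = divides (+ toℕ j) (pos-* (toℕ j) m)

    board-inject₁ : ∀ j → board (inject₁ j) ≡ offset j - a (inject₁ j)
    board-inject₁ j = cong (λ i → + (i ℕ.* m) - a (inject₁ j)) (toℕ-inject₁ j)

    board-suc : ∀ j → board (suc j) ≡ (+ m + offset j) - a (suc j)
    board-suc j = cong (_- a (suc j)) (pos-+ m (toℕ j ℕ.* m))

  board-step≤⇔stepBounded : ∀ j →
    (board (inject₁ j) ≤ board (suc j)) ⇔ (a (suc j) ≤ a (inject₁ j) + + m)
  board-step≤⇔stepBounded j =
    subst₂ (λ u v → (u ≤ v) ⇔ (a (suc j) ≤ a (inject₁ j) + + m))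
      (sym (board-inject₁ j)) (sym (board-suc j))
      (t-x≤k+t-y⇔y≤x+k (offset j) (+ m) (a (inject₁ j)) (a (suc j)))

  singleton⇒conditions : IsSingletonBoard m board → StepsBounded × InexactFloorsNonIncreasing
  singleton⇒conditions ((_ , mono) , step) = bounded , floors
    where
    bounded : StepsBounded
    bounded j = Equivalence.to (board-step≤⇔stepBounded j) (mono j)
    floors : InexactFloorsNonIncreasing
    floors j m∤y m∤x =
      singletonStep⇒⌊y⌋≤⌊x⌋ m (offset j) (a (inject₁ j)) (a (suc j)) (m∣offset j) m∤x m∤y
        (subst₂ (SingletonStep m) (board-inject₁ j) (board-suc j) (step j))

  conditions⇒singleton : a zero ≡ + 0 → StepsBounded × InexactFloorsNonIncreasing →
                         IsSingletonBoard m board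
  conditions⇒singleton a₀≡0 (bounded , floors) = (nonneg , mono) , step
    where
    mono : ∀ (j : Fin n) → board (inject₁ j) ≤ board (suc j)
    mono j = Equivalence.from (board-step≤⇔stepBounded j) (bounded j)
    nonneg : ∀ j → + 0 ≤ board j
    nonneg j = subst (_≤ board j) (cong (+ 0 -_) a₀≡0) (monotone⇒head≤ board mono j)
    step : ∀ (j : Fin n) → SingletonStep m (board (inject₁ j)) (board (suc j))
    step j = subst₂ (SingletonStep m) (sym (board-inject₁ j)) (sym (board-suc j))
      (⌊y⌋≤⌊x⌋⇒singletonStep m (offset j) (a (inject₁ j)) (a (suc j))
        (m∣offset j) (bounded j) (floors j))

  singleton⇒ζ≡a : IsSingletonBoard m board → ∀ j → ζ[ m ] board j ≡ a j
  singleton⇒ζ≡a (_ , step) j =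
    trans (ζ≡jm-b m board (singleton⇒remaindersAtZoneEnds m board step) j)
          (t-[t-x]≡x (+ (toℕ j ℕ.* m)) (a j))

proposition4p4 : (m : ℕ) → .{{_ : NonZero m}} → (n : ℕ) → (a : Fin (suc n) → ℤ) →
    a zero ≡ + 0 →
    ((IsSingletonBoard m (λ j → + (toℕ j Data.Nat.Base.* m) - a j) × (∀ j → ζ[ m ] (λ j → + (toℕ j Data.Nat.Base.* m) - a j) j ≡ a j))
      ⇔ ((∀ (j : Fin n) → a (suc j) ≤ a (inject₁ j) + + m) ×
         (∀ (j : Fin n) → ¬ (+ m ∣ a (suc j)) → ¬ (+ m ∣ a (inject₁ j)) →
            ⌊ a (suc j) ⌋[ m ] ≤ ⌊ a (inject₁ j) ⌋[ m ])))
proposition4p4 m n a a₀≡0 = mk⇔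
  (λ (singleton , _) → singleton⇒conditions singleton)
  (λ conditions → let singleton = conditions⇒singleton a₀≡0 conditions
                  in  singleton , singleton⇒ζ≡a singleton)
  where open Board m a
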